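{- Let $P,Q$ be integers and let $(U_n(P,Q))_{n\ge 0}$ be the Lucas sequence of the first type. Suppose $P$ is odd, $n$ is odd with $n \ge 3$, and $Q \equiv 2 \pmod 4$. Then $U_n(P,Q)$ is not a non-zero perfect square, i.e. there is no nonzero integer $m$ with $U_n(P,Q)=m^2$.
   Context: For fixed integers $P,Q$, the Lucas sequence of the first type is defined by $U_0(P,Q)=0$, $U_1(P,Q)=1$, and $U_n(P,Q)=P\cdot U_{n-1}(P,Q)-Q\cdot U_{n-2}(P,Q)$ for $n\ge 2$. -}

module Defs where

open import Data.Nat using (ℕ; zero; suc)
open import Data.Integer using (ℤ; +_; _*_; _-_; _+_)

U : ℤ → ℤ → ℕ → ℤ
U P Q zero = + 0
U P Q (suc zero) = + 1
U P Q (suc (suc n)) = P * U P Q (suc n) - Q * U P Q n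

module Submission where

-- Idea: reduce modulo 4.  Write P = 2p + 1 and Q = 4q + 2.  Modulo 4 the
-- recurrence U(k+2) = P U(k+1) - Q U(k) becomes U(k+2) ≡ P U(k+1) - 2 U(k),
-- and starting from U 2 = P, U 3 = P² - Q ≡ 3 one sees by induction that the
-- terms alternate: U(2j+2) ≡ P and U(2j+3) ≡ 3 (mod 4).  Every square is
-- 0 or 1 modulo 4, so no odd-index term U n with n ≥ 3 is a square at all.

open import Defs
open import Data.Nat using (ℕ; zero; suc; _<_; _≥_; s≤s; z≤n; NonZero; >-nonZero; _∸_)
  renaming (_+_ to _+ℕ_; _*_ to _*ℕ_)
open import Data.Nat.Properties using (<-cmp; m<n⇒0<n∸m; ≤-<-trans; m∸n≤m; <⇒≤; +-comm; *-suc)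
open import Data.Nat.Divisibility using (>⇒∤)
open import Data.Integer using (ℤ; +_; _+_; _*_; _-_; _⊖_)
open import Data.Integer.Properties using (m-n≡m⊖n; ≤-⊖) renaming (*-comm to *ℤ-comm)
open import Data.Integer.DivMod using (_/ℕ_; _%ℕ_; n%ℕd<d; a≡a%ℕn+[a/ℕn]*n)
open import Data.Integer.Divisibility.Signed using (divides; ∣⇒∣ᵤ)
open import Data.Integer.Tactic.RingSolver using (solve-∀)
open import Data.Product using (∃; _×_; _,_; proj₁; proj₂)
open import Data.Sum using (_⊎_; inj₁; inj₂)
open import Relation.Binary.PropositionalEquality
  using (_≡_; _≢_; refl; sym; trans; cong; subst; module ≡-Reasoning)
open import Relation.Nullary using (¬_)

Mod4 : ℤ → ℤ → Set
Mod4 x r = ∃ λ k → x ≡ + 4 * k + r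

4*w≢small : ∀ w {k} .{{_ : NonZero k}} → k < 4 → + 4 * w ≢ + k
4*w≢small w k<4 4w≡k = >⇒∤ k<4 (∣⇒∣ᵤ (divides w (trans (sym 4w≡k) (*ℤ-comm (+ 4) w))))

-- Distinct residues below 4 are incompatible: if r < s < 4 then
-- 4x + r = 4y + s would make 4(x - y) = s - r, a number in (0, 4).
distinct-residues : ∀ x y {r s} → r < s → s < 4 → + 4 * x + + r ≢ + 4 * y + + s
distinct-residues x y {r} {s} r<s s<4 eq =
  4*w≢small (x - y) {{>-nonZero (m<n⇒0<n∸m r<s)}} (≤-<-trans (m∸n≤m s r) s<4) 4[x-y]≡s∸r
  where
  isolate : ∀ a b c d → + 4 * (a - b) ≡ (+ 4 * a + c) - (+ 4 * b + d) + (d - c)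
  isolate = solve-∀

  cancel : ∀ z w → z - z + w ≡ w
  cancel = solve-∀

  open ≡-Reasoning
  4[x-y]≡s∸r : + 4 * (x - y) ≡ + (s ∸ r)
  4[x-y]≡s∸r = begin
    + 4 * (x - y)                                            ≡⟨ isolate x y (+ r) (+ s) ⟩
    (+ 4 * x + + r) - (+ 4 * y + + s) + (+ s - + r)          ≡⟨ cong (λ z → z - (+ 4 * y + + s) + (+ s - + r)) eq ⟩
    (+ 4 * y + + s) - (+ 4 * y + + s) + (+ s - + r)          ≡⟨ cancel (+ 4 * y + + s) (+ s - + r) ⟩
    + s - + r                                                ≡⟨ m-n≡m⊖n s r ⟩
    s ⊖ r                                                    ≡⟨ ≤-⊖ (<⇒≤ r<s) ⟩
    + (s ∸ r)                                                ∎

square-mod4 : ∀ m → Mod4 (m * m) (+ 0) ⊎ Mod4 (m * m) (+ 1)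
square-mod4 m with m %ℕ 2 | n%ℕd<d m 2 | a≡a%ℕn+[a/ℕn]*n m 2
... | 0 | _ | m≡2t = inj₁ (t * t , trans (cong (λ z → z * z) m≡2t) (even-square t))
  where
  t = m /ℕ 2
  even-square : ∀ t → (+ 0 + t * + 2) * (+ 0 + t * + 2) ≡ + 4 * (t * t) + + 0
  even-square = solve-∀
... | 1 | _ | m≡2t+1 = inj₂ (t * t + t , trans (cong (λ z → z * z) m≡2t+1) (odd-square t))
  where
  t = m /ℕ 2
  odd-square : ∀ t → (+ 1 + t * + 2) * (+ 1 + t * + 2) ≡ + 4 * (t * t + t) + + 1
  odd-square = solve-∀
... | suc (suc _) | s≤s (s≤s ()) | _

three-mod4-not-square : ∀ {x} m → Mod4 x (+ 3) → x ≢ m * m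
three-mod4-not-square m (a , x≡4a+3) x≡m² with square-mod4 m
... | inj₁ (y , m²≡4y) = distinct-residues y a (s≤s z≤n) (s≤s (s≤s (s≤s (s≤s z≤n))))
  (trans (sym m²≡4y) (trans (sym x≡m²) x≡4a+3))
... | inj₂ (y , m²≡4y+1) = distinct-residues y a (s≤s (s≤s z≤n)) (s≤s (s≤s (s≤s (s≤s z≤n))))
  (trans (sym m²≡4y+1) (trans (sym x≡m²) x≡4a+3))

module OddP-Q≡2mod4 (p q : ℤ) where
  P Q : ℤ
  P = + 2 * p + + 1
  Q = + 4 * q + + 2

  -- One step of the recurrence x, y ↦ P x - Q y modulo 4, in the two
  -- residue patterns that occur: (3, P) ↦ P and (P, 3) ↦ 3 (using P² ≡ 1).
  -- The polynomial identities are stated with P, Q expanded in p, q so that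
  -- the ring solver sees p and q as variables.
  step-to-P : ∀ {x y} → Mod4 x (+ 3) → Mod4 y P → Mod4 (P * x - Q * y) P
  step-to-P (a , refl) (b , refl) = P * a - q * P - + 4 * q * b - + 2 * b , identity p q a b
    where
    identity : ∀ p q a b →
      (+ 2 * p + + 1) * (+ 4 * a + + 3) - (+ 4 * q + + 2) * (+ 4 * b + (+ 2 * p + + 1))
        ≡ + 4 * ((+ 2 * p + + 1) * a - q * (+ 2 * p + + 1) - + 4 * q * b - + 2 * b) + (+ 2 * p + + 1)
    identity = solve-∀

  step-to-3 : ∀ {x y} → Mod4 x P → Mod4 y (+ 3) → Mod4 (P * x - Q * y) (+ 3)
  step-to-3 (b , refl) (a , refl) = P * b + p * p + p - + 4 * q * a - + 3 * q - + 2 * a - + 2 , identity p q a b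
    where
    identity : ∀ p q a b →
      (+ 2 * p + + 1) * (+ 4 * b + (+ 2 * p + + 1)) - (+ 4 * q + + 2) * (+ 4 * a + + 3)
        ≡ + 4 * ((+ 2 * p + + 1) * b + p * p + p - + 4 * q * a - + 3 * q - + 2 * a - + 2) + + 3
    identity = solve-∀

  -- Base: U 2 = P and U 3 = P² - Q = 4(p² + p - q - 1) + 3.  Step: the index
  -- 2(j + 1) equals 2 + 2j, so the next pair is obtained by the two steps above.
  alternation : ∀ j → Mod4 (U P Q (2 +ℕ 2 *ℕ j)) P × Mod4 (U P Q (3 +ℕ 2 *ℕ j)) (+ 3)
  alternation zero = (+ 0 , U2 p q) , (p * p + p - q - + 1 , U3 p q)
    where
    U2 : ∀ p q → (+ 2 * p + + 1) * + 1 - (+ 4 * q + + 2) * + 0 ≡ + 4 * + 0 + (+ 2 * p + + 1)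
    U2 = solve-∀
    U3 : ∀ p q → (+ 2 * p + + 1) * ((+ 2 * p + + 1) * + 1 - (+ 4 * q + + 2) * + 0) - (+ 4 * q + + 2) * + 1
                   ≡ + 4 * (p * p + p - q - + 1) + + 3
    U3 = solve-∀
  alternation (suc j) = subst shifted (sym (*-suc 2 j)) (next-even , step-to-3 next-even odd)
    where
    even : Mod4 (U P Q (2 +ℕ 2 *ℕ j)) P
    even = proj₁ (alternation j)
    odd : Mod4 (U P Q (3 +ℕ 2 *ℕ j)) (+ 3)
    odd = proj₂ (alternation j)
    next-even : Mod4 (U P Q (4 +ℕ 2 *ℕ j)) P
    next-even = step-to-P odd even
    shifted : ℕ → Set
    shifted i = Mod4 (U P Q (2 +ℕ i)) P × Mod4 (U P Q (3 +ℕ i)) (+ 3)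

  odd-term-mod4 : ∀ k → Mod4 (U P Q (2 *ℕ suc k +ℕ 1)) (+ 3)
  odd-term-mod4 k = subst (λ i → Mod4 (U P Q i) (+ 3)) (sym index)
                          (proj₂ (alternation k))
    where
    index : 2 *ℕ suc k +ℕ 1 ≡ 3 +ℕ 2 *ℕ k
    index = trans (+-comm (2 *ℕ suc k) 1) (cong (1 +ℕ_) (*-suc 2 k))

theorem3p2 : (P Q : ℤ) (n : ℕ) →
    (∃ λ k → P ≡ + 2 * k + + 1) →
    (∃ λ k → n ≡ 2 *ℕ k +ℕ 1) → n ≥ 3 →
    (∃ λ k → Q ≡ + 4 * k + + 2) →
    ¬ (∃ λ (m : ℤ) → m ≢ + 0 × U P Q n ≡ m * m)
theorem3p2 _ _ _ _ (zero , refl) (s≤s ()) _ _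
theorem3p2 _ _ _ (p , refl) (suc k , refl) _ (q , refl) (m , _ , Uₙ≡m²) =
  three-mod4-not-square m (OddP-Q≡2mod4.odd-term-mod4 p q k) Uₙ≡m²
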